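{- Let $\mathfrak{T}=\langle\mathcal{M},\mathcal{E}\rangle$ be a constrained equational theory over a signature $\Sigma$, and $\mathfrak{M}=\langle\mathfrak{I},\mathfrak{J}\rangle$ a CE-$\langle\Sigma,\mathcal{M}\rangle$-algebra in which every CE of $\mathcal{E}$ is valid. If $s\leftrightarrow^*_\mathcal{E}t$, then $[\![s]\!]_{\mathfrak{M},\rho}=[\![t]\!]_{\mathfrak{M},\rho}$ for every valuation $\rho$ on $\mathfrak{M}$.
   Context: Signature $\Sigma$: sorts $\mathcal{S} = \mathcal{S}_{th} \uplus \mathcal{S}_{te}$ (theory/term sorts), function symbols $\mathcal{F} = \mathcal{F}_{th} \uplus \mathcal{F}_{te}$ with sort declarations; theory symbols have only theory sorts. Sorted variables $\mathcal{V} = \mathcal{V}_{th}\uplus\mathcal{V}_{te}$. A model $\mathcal{M} = \langle \mathcal{I},\mathcal{J}\rangle$ assigns a non-empty set $\mathcal{I}(\tau)$ to each theory sort and a function $\mathcal{J}(f)$ to each $f \in\mathcal{F}_{th}$; for each theory sort $\tau$ a set $\mathrm{Val}_\tau\subseteq\mathcal{F}_{th}$ of constants ("values") is mapped bijectively onto $\mathcal{I}(\tau)$ by $\mathcal{J}$ (values identified with their interpretations); $\mathrm{Val}=\bigcup_\tau\mathrm{Val}_\tau$. Sort $\mathsf{Bool}$ with $\mathcal{I}(\mathsf{Bool})=\{\mathsf{true},\mathsf{false}\}$, standard connectives and equality symbols. Logical constraints: terms of $\mathcal{T}(\mathcal{F}_{th},\mathcal{V})$ of sort $\mathsf{Bool}$;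 $\models_\mathcal{M}\varphi$ means true under every valuation. Substitutions: sort-preserving, finite domain; $\mathcal{V}\mathrm{Dom}(\sigma)=\{x\in\mathrm{Dom}(\sigma)\mid\sigma(x)\in\mathrm{Val}\}$; $\sigma$ is $X$-valued if $X\subseteq\mathcal{V}\mathrm{Dom}(\sigma)$. Calculation step $s\to_{calc}t$: $s=C[f(c_1,\dots,c_n)]$, $t=C[c_0]$, $f\in\mathcal{F}_{th}\setminus\mathrm{Val}$, $c_i\in\mathrm{Val}$, $c_0=\mathcal{J}(f)(c_1,\dots,c_n)$; $\leftrightarrow_{calc}$ its symmetric closure. A CE $\Pi X.\ s\approx t\ [\varphi]$: terms of equal sort, logical constraint $\varphi$, $X\subseteq\mathcal{V}_{th}$ with $\mathrm{Var}(\varphi)\subseteq X$. Theory $\langle\mathcal{M},\mathcal{E}\rangle$: $\mathcal{E}$ a set of CEs. $s\leftrightarrow_{rule,\mathcal{E}}t$ iff $s=C[\ell\sigma]$, $t=C[r\sigma]$ (or vice versa) for some $\Pi X.\ \ell\approx r\ [\varphi]\in\mathcal{E}$ and $X$-valued $\sigma$ with $\models_\mathcal{M}\varphi\sigma$; $\leftrightarrow_\mathcal{E}=\leftrightarrow_{calc}\cup\leftrightarrow_{rule,\mathcal{E}}$. A CE-$\langle\Sigma,\mathcal{M}\rangle$-algebra $\mathfrak{M}=\langle\mathfrak{I},\mathfrak{J}\rangle$ assigns a non-empty set $\mathfrak{I}(\tau)$ to each $\tau\in\mathcal{S}$ and a function $\mathfrak{J}(f)\colon\mathfrak{I}(\tau_1)\times\cdots\times\mathfrak{I}(\tau_n)\to\mathfrak{I}(\tau_0)$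 to each $f\in\mathcal{F}$, with $\mathfrak{I}(\tau)\supseteq\mathcal{I}(\tau)$ for $\tau\in\mathcal{S}_{th}$ and $\mathfrak{J}(f)$ agreeing with $\mathcal{J}(f)$ on arguments from the $\mathcal{I}(\tau_i)$ for $f\in\mathcal{F}_{th}$. A valuation $\rho$ on $\mathfrak{M}$ maps each variable of sort $\tau$ into $\mathfrak{I}(\tau)$; $[\![t]\!]_{\mathfrak{M},\rho}$ is the usual evaluation. A CE $\Pi X.\ \ell\approx r\ [\varphi]$ is valid in $\mathfrak{M}$ if $[\![\ell]\!]_{\mathfrak{M},\rho}=[\![r]\!]_{\mathfrak{M},\rho}$ for all valuations $\rho$ with $[\![\varphi]\!]_{\mathfrak{M},\rho}=\mathsf{true}$ and $\rho(x)\in\mathcal{I}(\tau)$ for all $x^\tau\in X$. -}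

module Defs where

open import Data.Bool using (Bool; true; false)
open import Data.Unit using (⊤)
open import Data.List using (List; []; _∷_; map)
open import Data.List.Relation.Unary.All as All using (All; []; _∷_)
open import Data.List.Relation.Unary.All.Properties using (map⁻)
open import Data.List.Membership.Propositional using (_∈_)
open import Data.Product using (Σ; _×_; _,_; proj₁)
open import Data.Sum using (_⊎_; inj₁; inj₂)
open import Relation.Nullary using (¬_)
open import Relation.Binary.PropositionalEquality using (_≡_; subst; sym)
open import Relation.Binary.Construct.Closure.ReflexiveTransitive using (Star)

-- Function symbols are given together with their
-- sort declaration: a theory symbol f : [τ₁,…,τₙ] ⇒ τ₀ is an element of
-- FTh (τ₁ ∷ … ∷ τₙ ∷ []) τ₀ (only theory sorts!), a term symbol is an
-- element of FTe σs σ (arbitrary sorts).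

record Signature : Set₁ where
  field
    ThSort : Set
    TeSort : Set
    boolS  : ThSort
    FTh    : List ThSort → ThSort → Set
    FTe    : List (ThSort ⊎ TeSort) → (ThSort ⊎ TeSort) → Set
    Var    : ThSort ⊎ TeSort → Set

module Syn (Sig : Signature) where
  open Signature Sig public

  Sort : Set
  Sort = ThSort ⊎ TeSort

  data Term : Sort → Set
  data Terms : List Sort → Set

  data Term where
    var   : ∀ {σ} → Var σ → Term σ
    thApp : ∀ {τs τ} → FTh τs τ → Terms (map inj₁ τs) → Term (inj₁ τ)
    teApp : ∀ {σs σ} → FTe σs σ → Terms σs → Term σ

  data Terms where
    []  : Terms []
    _∷_ : ∀ {σ σs} → Term σ → Terms σs → Terms (σ ∷ σs)

  data ThTerm : ThSort → Set
  data ThTerms : List ThSort → Set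

  data ThTerm where
    var : ∀ {τ} → Var (inj₁ τ) → ThTerm τ
    app : ∀ {τs τ} → FTh τs τ → ThTerms τs → ThTerm τ

  data ThTerms where
    []  : ThTerms []
    _∷_ : ∀ {τ τs} → ThTerm τ → ThTerms τs → ThTerms (τ ∷ τs)

  ⌜_⌝  : ∀ {τ} → ThTerm τ → Term (inj₁ τ)
  ⌜_⌝s : ∀ {τs} → ThTerms τs → Terms (map inj₁ τs)
  ⌜ var x ⌝    = var x
  ⌜ app f ts ⌝ = thApp f ⌜ ts ⌝s
  ⌜ [] ⌝s      = []
  ⌜ t ∷ ts ⌝s  = ⌜ t ⌝ ∷ ⌜ ts ⌝s

  VarSet : Set₁
  VarSet = ∀ {τ} → Var (inj₁ τ) → Set

  VarsIn  : VarSet → ∀ {τ} → ThTerm τ → Set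
  VarsIns : VarSet → ∀ {τs} → ThTerms τs → Set
  VarsIn X (var x)      = X x
  VarsIn X (app f ts)   = VarsIns X ts
  VarsIns X []          = ⊤
  VarsIns X (t ∷ ts)    = VarsIn X t × VarsIns X ts

  RawSubst : Set
  RawSubst = ∀ {σ} → Var σ → Term σ

  FiniteDom : RawSubst → Set
  FiniteDom θ = Σ (List (Σ Sort Var)) λ L →
                  ∀ {σ} (x : Var σ) → ¬ ((σ , x) ∈ L) → θ x ≡ var x

  _⟨_⟩  : ∀ {σ} → Term σ → RawSubst → Term σ
  _⟨_⟩s : ∀ {σs} → Terms σs → RawSubst → Terms σs
  var x ⟨ θ ⟩        = θ x
  thApp f ts ⟨ θ ⟩   = thApp f (ts ⟨ θ ⟩s)
  teApp f ts ⟨ θ ⟩   = teApp f (ts ⟨ θ ⟩s)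
  [] ⟨ θ ⟩s          = []
  (t ∷ ts) ⟨ θ ⟩s    = (t ⟨ θ ⟩) ∷ (ts ⟨ θ ⟩s)

  record CE : Set₁ where
    field
      X      : VarSet
      sort   : Sort
      lhs    : Term sort
      rhs    : Term sort
      φ      : ThTerm boolS
      φ-vars : VarsIn X φ

  record Model : Set₁ where
    field
      I      : ThSort → Set
      I-nonempty : ∀ τ → I τ
      J      : ∀ {τs τ} → FTh τs τ → All I τs → I τ
      IsVal  : ∀ {τ} → FTh [] τ → Set
      val-inj  : ∀ {τ} (c d : FTh [] τ) → IsVal c → IsVal d → J c [] ≡ J d [] → c ≡ d
      val-surj : ∀ {τ} (a : I τ) → Σ (FTh [] τ) λ c → IsVal c × J c [] ≡ a
      I-bool : I boolS ≡ Bool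

module Sem (Sig : Signature) (M : Syn.Model Sig) where
  open Syn Sig
  open Model M public

  trueᴵ : I boolS
  trueᴵ = subst (λ A → A) (sym I-bool) true

  ThValuation : Set
  ThValuation = ∀ {τ} → Var (inj₁ τ) → I τ

  evalM  : ThValuation → ∀ {τ} → ThTerm τ → I τ
  evalMs : ThValuation → ∀ {τs} → ThTerms τs → All I τs
  evalM ρ (var x)     = ρ x
  evalM ρ (app f ts)  = J f (evalMs ρ ts)
  evalMs ρ []         = []
  evalMs ρ (t ∷ ts)   = evalM ρ t ∷ evalMs ρ ts

  ⊨M : ThTerm boolS → Set
  ⊨M φ = ∀ (ρ : ThValuation) → evalM ρ φ ≡ trueᴵ

  ⊨M-term : Term (inj₁ boolS) → Set
  ⊨M-term u = Σ (ThTerm boolS) λ ψ → (⌜ ψ ⌝ ≡ u) × ⊨M ψ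

  Value : ThSort → Set
  Value τ = Σ (FTh [] τ) IsVal

  data IsValTerm : ∀ {σ} → Term σ → Set where
    isVal : ∀ {τ} (c : FTh [] τ) → IsVal c → IsValTerm (thApp c [])

  XValued : VarSet → RawSubst → Set
  XValued X θ = ∀ {τ} (x : Var (inj₁ τ)) → X x → IsValTerm (θ x)

  valTerms : ∀ {τs} → All Value τs → Terms (map inj₁ τs)
  valTerms []             = []
  valTerms ((c , _) ∷ cs) = thApp c [] ∷ valTerms cs

  valInterp : ∀ {τs} → All Value τs → All I τs
  valInterp = All.map (λ v → J (proj₁ v) [])

  NonVal : ∀ {τs τ} → FTh τs τ → Set
  NonVal {[]}    f = ¬ IsVal f
  NonVal {_ ∷ _} f = ⊤

  data Ctx (R : ∀ {σ} → Term σ → Term σ → Set₁) : ∀ {σ} → Term σ → Term σ → Set₁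
  data Ctxs (R : ∀ {σ} → Term σ → Term σ → Set₁) : ∀ {σs} → Terms σs → Terms σs → Set₁

  data Ctx R where
    root  : ∀ {σ} {s t : Term σ} → R s t → Ctx R s t
    thArg : ∀ {τs τ} (f : FTh τs τ) {ss ts} → Ctxs R ss ts → Ctx R (thApp f ss) (thApp f ts)
    teArg : ∀ {σs σ} (f : FTe σs σ) {ss ts} → Ctxs R ss ts → Ctx R (teApp f ss) (teApp f ts)

  data Ctxs R where
    here  : ∀ {σ σs} {s t : Term σ} {ss : Terms σs} → Ctx R s t → Ctxs R (s ∷ ss) (t ∷ ss)
    there : ∀ {σ σs} {s : Term σ} {ss ts : Terms σs} → Ctxs R ss ts → Ctxs R (s ∷ ss) (s ∷ ts)

  data CalcRoot : ∀ {σ} → Term σ → Term σ → Set₁ where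
    calc : ∀ {τs τ} (f : FTh τs τ) → NonVal f → (cs : All Value τs) →
           (c₀ : FTh [] τ) → IsVal c₀ → J c₀ [] ≡ J f (valInterp cs) →
           CalcRoot (thApp f (valTerms cs)) (thApp c₀ [])

  data RuleRoot (E : CE → Set) : ∀ {σ} → Term σ → Term σ → Set₁ where
    fwd : (e : CE) → E e → (θ : RawSubst) → FiniteDom θ → XValued (CE.X e) θ →
          ⊨M-term (⌜ CE.φ e ⌝ ⟨ θ ⟩) →
          RuleRoot E (CE.lhs e ⟨ θ ⟩) (CE.rhs e ⟨ θ ⟩)
    bwd : (e : CE) → E e → (θ : RawSubst) → FiniteDom θ → XValued (CE.X e) θ →
          ⊨M-term (⌜ CE.φ e ⌝ ⟨ θ ⟩) →
          RuleRoot E (CE.rhs e ⟨ θ ⟩) (CE.lhs e ⟨ θ ⟩)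

  _→calc_ : ∀ {σ} → Term σ → Term σ → Set₁
  s →calc t = Ctx CalcRoot s t

  _↔calc_ : ∀ {σ} → Term σ → Term σ → Set₁
  s ↔calc t = (s →calc t) ⊎ (t →calc s)

  _↔rule[_]_ : ∀ {σ} → Term σ → (CE → Set) → Term σ → Set₁
  s ↔rule[ E ] t = Ctx (RuleRoot E) s t

  _↔[_]_ : ∀ {σ} → Term σ → (CE → Set) → Term σ → Set₁
  s ↔[ E ] t = (s ↔calc t) ⊎ (s ↔rule[ E ] t)

  _↔*[_]_ : ∀ {σ} → Term σ → (CE → Set) → Term σ → Set₁
  s ↔*[ E ] t = Star (λ u v → u ↔[ E ] v) s t

  -- CE-⟨Σ,M⟩-algebras.  𝔍(τ) ⊇ I(τ) is modelled by an injection emb.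
  record Algebra : Set₁ where
    field
      Car     : Sort → Set
      Car-nonempty : ∀ σ → Car σ
      emb     : ∀ {τ} → I τ → Car (inj₁ τ)
      emb-inj : ∀ {τ} {a b : I τ} → emb a ≡ emb b → a ≡ b
      Jth     : ∀ {τs τ} → FTh τs τ → All (λ τ′ → Car (inj₁ τ′)) τs → Car (inj₁ τ)
      Jte     : ∀ {σs σ} → FTe σs σ → All Car σs → Car σ
      agree   : ∀ {τs τ} (f : FTh τs τ) (as : All I τs) →
                Jth f (All.map emb as) ≡ emb (J f as)

  module Alg (𝔐 : Algebra) where
    open Algebra 𝔐 public

    Valuation : Set
    Valuation = ∀ {σ} → Var σ → Car σ

    ⟦_⟧_  : ∀ {σ} → Term σ → Valuation → Car σ
    ⟦_⟧s_ : ∀ {σs} → Terms σs → Valuation → All Car σs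
    ⟦ var x ⟧ ρ       = ρ x
    ⟦ thApp f ts ⟧ ρ  = Jth f (map⁻ (⟦ ts ⟧s ρ))
    ⟦ teApp f ts ⟧ ρ  = Jte f (⟦ ts ⟧s ρ)
    ⟦ [] ⟧s ρ         = []
    ⟦ t ∷ ts ⟧s ρ     = (⟦ t ⟧ ρ) ∷ (⟦ ts ⟧s ρ)

    Valid : CE → Set
    Valid e = ∀ (ρ : Valuation) →
              ⟦ ⌜ CE.φ e ⌝ ⟧ ρ ≡ emb trueᴵ →
              (∀ {τ} (x : Var (inj₁ τ)) → CE.X e x → Σ (I τ) λ a → ρ x ≡ emb a) →
              ⟦ CE.lhs e ⟧ ρ ≡ ⟦ CE.rhs e ⟧ ρ

-- Each root step preserves the value of a term in 𝔐 under every valuation, and this property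
-- survives contexts, symmetry and reflexive–transitive closure. A calculation step is sound
-- because 𝔐 extends M. A rule step instantiates a valid CE with an X-valued substitution θ;
-- the instance of its constraint is then ground, so its value in 𝔐 does not depend on the
-- valuation and may be computed under one that takes theory variables into I, where 𝔐 agrees
-- with M and the constraint holds.
module Submission where

open import Defs
open import Data.List.Relation.Unary.All as All using (All; []; _∷_)
open import Data.List.Relation.Unary.All.Properties using (map⁻)
open import Data.Product using (Σ; _,_)
open import Data.Sum using (inj₁; inj₂)
open import Relation.Binary.Core using (Rel)
open import Relation.Binary.PropositionalEquality
  using (_≡_; refl; sym; trans; cong; cong₂; module ≡-Reasoning)
open import Relation.Binary.Construct.Closure.ReflexiveTransitive using (Star; ε; _◅_)

module Soundness (Sig : Signature) (M : Syn.Model Sig) (𝔐 : Sem.Algebra Sig M) where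
  open Syn Sig
  open Sem Sig M
  open Alg 𝔐

  infix 4 _≐_
  _≐_ : ∀ {σ} → Term σ → Term σ → Set
  s ≐ t = ∀ (ρ : Valuation) → ⟦ s ⟧ ρ ≡ ⟦ t ⟧ ρ

  TermRel : Set₂
  TermRel = ∀ {σ} → Term σ → Term σ → Set₁

  Sound : TermRel → Set₁
  Sound R = ∀ {σ} {s t : Term σ} → R s t → s ≐ t

  Ctx-sound  : ∀ {R : TermRel} → Sound R → Sound (Ctx R)
  Ctxs-sound : ∀ {R : TermRel} → Sound R → ∀ {σs} {ss ts : Terms σs} → Ctxs R ss ts →
               ∀ (ρ : Valuation) → ⟦ ss ⟧s ρ ≡ ⟦ ts ⟧s ρ
  Ctx-sound sound (root r)    ρ = sound r ρ
  Ctx-sound sound (thArg f c) ρ = cong (λ as → Jth f (map⁻ as)) (Ctxs-sound sound c ρ)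
  Ctx-sound sound (teArg f c) ρ = cong (Jte f) (Ctxs-sound sound c ρ)
  Ctxs-sound sound (here c)  ρ = cong (_∷ _) (Ctx-sound sound c ρ)
  Ctxs-sound sound (there c) ρ = cong (_ ∷_) (Ctxs-sound sound c ρ)

  Star-sound : ∀ {σ ℓ} {R : Rel (Term σ) ℓ} → (∀ {s t} → R s t → s ≐ t) →
               ∀ {s t} → Star R s t → s ≐ t
  Star-sound sound ε        ρ = refl
  Star-sound sound (r ◅ rs) ρ = trans (sound r ρ) (Star-sound sound rs ρ)

  ⟦valTerms⟧ : ∀ {τs} (cs : All Value τs) (ρ : Valuation) →
               map⁻ (⟦ valTerms cs ⟧s ρ) ≡ All.map emb (valInterp cs)
  ⟦valTerms⟧ []             ρ = refl
  ⟦valTerms⟧ ((c , _) ∷ cs) ρ = cong₂ _∷_ (agree c []) (⟦valTerms⟧ cs ρ)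

  CalcRoot-sound : Sound CalcRoot
  CalcRoot-sound (calc f _ cs c₀ _ c₀≡fcs) ρ = begin
    Jth f (map⁻ (⟦ valTerms cs ⟧s ρ)) ≡⟨ cong (Jth f) (⟦valTerms⟧ cs ρ) ⟩
    Jth f (All.map emb (valInterp cs)) ≡⟨ agree f (valInterp cs) ⟩
    emb (J f (valInterp cs))           ≡⟨ cong emb (sym c₀≡fcs) ⟩
    emb (J c₀ [])                      ≡⟨ sym (agree c₀ []) ⟩
    Jth c₀ []                          ∎
    where open ≡-Reasoning

  ↔calc-sound : Sound _↔calc_
  ↔calc-sound (inj₁ s→t) ρ = Ctx-sound CalcRoot-sound s→t ρ
  ↔calc-sound (inj₂ t→s) ρ = sym (Ctx-sound CalcRoot-sound t→s ρ)

  ⟦⟨⟩⟧  : ∀ {σ} (t : Term σ) (θ : RawSubst) (ρ : Valuation) →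
          ⟦ t ⟨ θ ⟩ ⟧ ρ ≡ ⟦ t ⟧ (λ x → ⟦ θ x ⟧ ρ)
  ⟦⟨⟩⟧s : ∀ {σs} (ts : Terms σs) (θ : RawSubst) (ρ : Valuation) →
          ⟦ ts ⟨ θ ⟩s ⟧s ρ ≡ ⟦ ts ⟧s (λ x → ⟦ θ x ⟧ ρ)
  ⟦⟨⟩⟧ (var x)      θ ρ = refl
  ⟦⟨⟩⟧ (thApp f ts) θ ρ = cong (λ as → Jth f (map⁻ as)) (⟦⟨⟩⟧s ts θ ρ)
  ⟦⟨⟩⟧ (teApp f ts) θ ρ = cong (Jte f) (⟦⟨⟩⟧s ts θ ρ)
  ⟦⟨⟩⟧s []       θ ρ = refl
  ⟦⟨⟩⟧s (t ∷ ts) θ ρ = cong₂ _∷_ (⟦⟨⟩⟧ t θ ρ) (⟦⟨⟩⟧s ts θ ρ)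

  ⟦value⟧ : ∀ {τ} {u : Term (inj₁ τ)} → IsValTerm u →
            Σ (I τ) λ a → ∀ (ρ : Valuation) → ⟦ u ⟧ ρ ≡ emb a
  ⟦value⟧ (isVal c _) = J c [] , λ ρ → agree c []

  module _ {X : VarSet} {θ : RawSubst} (θ-val : XValued X θ) where

    ⟦⌜⌝⟨⟩⟧-const  : ∀ {τ} (φ : ThTerm τ) → VarsIn X φ →
                    ∀ (ρ ρ′ : Valuation) → ⟦ ⌜ φ ⌝ ⟨ θ ⟩ ⟧ ρ ≡ ⟦ ⌜ φ ⌝ ⟨ θ ⟩ ⟧ ρ′
    ⟦⌜⌝⟨⟩⟧s-const : ∀ {τs} (φs : ThTerms τs) → VarsIns X φs →
                    ∀ (ρ ρ′ : Valuation) → ⟦ ⌜ φs ⌝s ⟨ θ ⟩s ⟧s ρ ≡ ⟦ ⌜ φs ⌝s ⟨ θ ⟩s ⟧s ρ′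
    ⟦⌜⌝⟨⟩⟧-const (var x) x∈X ρ ρ′ =
      let (_ , ⟦θx⟧≡a) = ⟦value⟧ (θ-val x x∈X) in trans (⟦θx⟧≡a ρ) (sym (⟦θx⟧≡a ρ′))
    ⟦⌜⌝⟨⟩⟧-const (app f φs) vars ρ ρ′ = cong (λ as → Jth f (map⁻ as)) (⟦⌜⌝⟨⟩⟧s-const φs vars ρ ρ′)
    ⟦⌜⌝⟨⟩⟧s-const []       _             ρ ρ′ = refl
    ⟦⌜⌝⟨⟩⟧s-const (φ ∷ φs) (vars , varss) ρ ρ′ =
      cong₂ _∷_ (⟦⌜⌝⟨⟩⟧-const φ vars ρ ρ′) (⟦⌜⌝⟨⟩⟧s-const φs varss ρ ρ′)

  module _ (ρ₀ : ThValuation) (ρ : Valuation) (ρ≡ρ₀ : ∀ {τ} (x : Var (inj₁ τ)) → ρ x ≡ emb (ρ₀ x)) where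

    ⟦⌜⌝⟧≡evalM   : ∀ {τ} (ψ : ThTerm τ) → ⟦ ⌜ ψ ⌝ ⟧ ρ ≡ emb (evalM ρ₀ ψ)
    ⟦⌜⌝⟧s≡evalMs : ∀ {τs} (ψs : ThTerms τs) → map⁻ (⟦ ⌜ ψs ⌝s ⟧s ρ) ≡ All.map emb (evalMs ρ₀ ψs)
    ⟦⌜⌝⟧≡evalM (var x)    = ρ≡ρ₀ x
    ⟦⌜⌝⟧≡evalM (app f ψs) = trans (cong (Jth f) (⟦⌜⌝⟧s≡evalMs ψs)) (agree f (evalMs ρ₀ ψs))
    ⟦⌜⌝⟧s≡evalMs []       = refl
    ⟦⌜⌝⟧s≡evalMs (ψ ∷ ψs) = cong₂ _∷_ (⟦⌜⌝⟧≡evalM ψ) (⟦⌜⌝⟧s≡evalMs ψs)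

  ⊨M-term⇒true : ∀ {u : Term (inj₁ boolS)} →
                 (∀ (ρ ρ′ : Valuation) → ⟦ u ⟧ ρ ≡ ⟦ u ⟧ ρ′) → ⊨M-term u →
                 ∀ (ρ : Valuation) → ⟦ u ⟧ ρ ≡ emb trueᴵ
  ⊨M-term⇒true u-const (ψ , refl , ⊨ψ) ρ = begin
    ⟦ ⌜ ψ ⌝ ⟧ ρ         ≡⟨ u-const ρ ρᴵ ⟩
    ⟦ ⌜ ψ ⌝ ⟧ ρᴵ        ≡⟨ ⟦⌜⌝⟧≡evalM ρ₀ ρᴵ (λ x → refl) ψ ⟩
    emb (evalM ρ₀ ψ)    ≡⟨ cong emb (⊨ψ ρ₀) ⟩
    emb trueᴵ           ∎
    where
    open ≡-Reasoning
    ρ₀ : ThValuation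
    ρ₀ {τ} _ = I-nonempty τ
    ρᴵ : Valuation
    ρᴵ {inj₁ τ} x = emb (ρ₀ x)
    ρᴵ {inj₂ σ} _ = Car-nonempty (inj₂ σ)

  module _ (E : CE → Set) (valid : ∀ (e : CE) → E e → Valid e) where

    instance-sound : ∀ (e : CE) → E e → ∀ (θ : RawSubst) → XValued (CE.X e) θ →
                     ⊨M-term (⌜ CE.φ e ⌝ ⟨ θ ⟩) → CE.lhs e ⟨ θ ⟩ ≐ CE.rhs e ⟨ θ ⟩
    instance-sound e e∈E θ θ-val ⊨φθ ρ = begin
      ⟦ CE.lhs e ⟨ θ ⟩ ⟧ ρ ≡⟨ ⟦⟨⟩⟧ (CE.lhs e) θ ρ ⟩
      ⟦ CE.lhs e ⟧ ρθ      ≡⟨ valid e e∈E ρθ φ-true θ-in-I ⟩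
      ⟦ CE.rhs e ⟧ ρθ      ≡⟨ sym (⟦⟨⟩⟧ (CE.rhs e) θ ρ) ⟩
      ⟦ CE.rhs e ⟨ θ ⟩ ⟧ ρ ∎
      where
      open ≡-Reasoning
      ρθ : Valuation
      ρθ x = ⟦ θ x ⟧ ρ
      φ-true : ⟦ ⌜ CE.φ e ⌝ ⟧ ρθ ≡ emb trueᴵ
      φ-true = trans (sym (⟦⟨⟩⟧ ⌜ CE.φ e ⌝ θ ρ))
                     (⊨M-term⇒true (⟦⌜⌝⟨⟩⟧-const θ-val (CE.φ e) (CE.φ-vars e)) ⊨φθ ρ)
      θ-in-I : ∀ {τ} (x : Var (inj₁ τ)) → CE.X e x → Σ (I τ) λ a → ρθ x ≡ emb a
      θ-in-I x x∈X = let (a , ⟦θx⟧≡a) = ⟦value⟧ (θ-val x x∈X) in a , ⟦θx⟧≡a ρ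

    RuleRoot-sound : Sound (RuleRoot E)
    RuleRoot-sound (fwd e e∈E θ _ θ-val ⊨φθ) ρ = instance-sound e e∈E θ θ-val ⊨φθ ρ
    RuleRoot-sound (bwd e e∈E θ _ θ-val ⊨φθ) ρ = sym (instance-sound e e∈E θ θ-val ⊨φθ ρ)

    ↔-sound : ∀ {σ} {s t : Term σ} → s ↔[ E ] t → s ≐ t
    ↔-sound (inj₁ s↔t) = ↔calc-sound s↔t
    ↔-sound (inj₂ s↔t) = Ctx-sound RuleRoot-sound s↔t

lemma40 : (Sig : Signature) → let open Syn Sig in
          (M : Model) (E : CE → Set) → let open Sem Sig M in
          (𝔐 : Algebra) → let open Alg 𝔐 in
          (∀ (e : CE) → E e → Valid e) →
          ∀ {σ} {s t : Term σ} → s ↔*[ E ] t →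
          ∀ (ρ : Valuation) → ⟦ s ⟧ ρ ≡ ⟦ t ⟧ ρ
lemma40 Sig M E 𝔐 valid = Star-sound (↔-sound E valid)
  where open Soundness Sig M 𝔐
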